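{- Suppose $M$ is any structure and $\theta(\bar z)$ is a mutually algebraic formula. Then $\theta(\bar z)$ supports an infinite array if and only if $\theta(\bar z)$ is not algebraic, i.e., $M\models\exists^\infty\bar z\,\theta(\bar z)$.
   Context: A formula $\theta(\bar z)$ is mutually algebraic (in $M$) if there is $K$ such that each element of $M$ occurs in at most $K$ tuples satisfying $\theta$. A mutually algebraic formula $\theta(\bar z)$ supports an infinite array if there is an infinite set $\{\bar d_i:i\in\omega\}$ of realizations of $\theta$ in $M$ that are pairwise disjoint (as sets of elements). -}

module Defs where

open import Level using (Level)
open import Data.Nat using (ℕ; suc)
open import Data.Fin using (Fin)
open import Data.Product using (Σ; ∃; _×_)
open import Data.Empty using (⊥)
open import Relation.Nullary using (¬_)
open import Relation.Binary.PropositionalEquality using (_≡_; _≢_)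

Tuple : ∀ {ℓ} → Set ℓ → ℕ → Set ℓ
Tuple M n = Fin n → M

Distinct : ∀ {ℓ} {M : Set ℓ} {n : ℕ} → Tuple M n → Tuple M n → Set ℓ
Distinct t s = ¬ (∀ k → t k ≡ s k)

PairwiseDistinct : ∀ {ℓ} {M : Set ℓ} {n : ℕ} {I : Set} → (I → Tuple M n) → Set ℓ
PairwiseDistinct {I = I} xs = ∀ (i j : I) → i ≢ j → Distinct (xs i) (xs j)

OccursIn : ∀ {ℓ} {M : Set ℓ} {n : ℕ} → M → Tuple M n → Set ℓ
OccursIn {n = n} a t = Σ (Fin n) λ k → t k ≡ a

Disjoint : ∀ {ℓ} {M : Set ℓ} {n : ℕ} → Tuple M n → Tuple M n → Set ℓ
Disjoint t s = ∀ k l → t k ≢ s l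

AtMost : ∀ {ℓ} {M : Set ℓ} {n : ℕ} → ℕ → (Tuple M n → Set ℓ) → Set ℓ
AtMost {M = M} {n} K P =
  (xs : Fin (suc K) → Tuple M n) → (∀ i → P (xs i)) → PairwiseDistinct xs → ⊥

MutuallyAlgebraic : ∀ {ℓ} {M : Set ℓ} {n : ℕ} → (Tuple M n → Set ℓ) → Set ℓ
MutuallyAlgebraic {M = M} θ =
  Σ ℕ λ K → (a : M) → AtMost K (λ t → θ t × OccursIn a t)

InfinitelyMany : ∀ {ℓ} {M : Set ℓ} {n : ℕ} → (Tuple M n → Set ℓ) → Set ℓ
InfinitelyMany {M = M} {n} θ =
  (N : ℕ) → Σ (Fin N → Tuple M n) λ xs → (∀ i → θ (xs i)) × PairwiseDistinct xs

SupportsInfiniteArray : ∀ {ℓ} {M : Set ℓ} {n : ℕ} → (Tuple M n → Set ℓ) → Set ℓ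
SupportsInfiniteArray {M = M} {n} θ =
  Σ (ℕ → Tuple M n) λ d →
    (∀ i → θ (d i)) × PairwiseDistinct d × (∀ i j → i ≢ j → Disjoint (d i) (d j))

module Submission where

-- (⇒) is immediate: the terms of an infinite array are infinitely many
-- pairwise distinct realizations.
--
-- (⇐) is a greedy construction. Let K bound, for every a ∈ M, the number of
-- realizations containing a. If A is a finite set of elements, every family of
-- pairwise distinct realizations all meeting A has at most |A|·K members
-- (count the realizations through each a ∈ A). So among |A|·K + 1 distinct
-- realizations one misses A. Taking for A the elements of d₀, …, d_{m-1} gives
-- a realization d_m disjoint from all earlier ones, and the sequence (d_m) is an
-- infinite array. Excluded middle is used to decide occurrence of elements and
-- to find the realization missing A.

open import Defs
open import Level using (Level)
open import Data.Nat using (ℕ)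
open import Data.Product using (_×_)
open import Axiom.ExcludedMiddle using (ExcludedMiddle)

open import Data.Nat using (zero; suc; _≤_; _<_; _+_; _*_; _≟_; _≤?_; z≤n; s≤s)
open import Data.Nat.Properties
  using (≤∧≢⇒<; <-cmp; +-mono-≤; +-suc; ≤-trans; ≤-reflexive; n≮n; ≰⇒>)
open import Data.Fin using (Fin; toℕ) renaming (zero to fzero; suc to fsuc)
open import Data.Fin.Properties using (toℕ-injective)
open import Data.Product using (Σ; _,_; proj₁; proj₂)
open import Data.Empty using (⊥-elim)
open import Data.List using (List; []; _∷_; length; filter; tabulate; _++_)
open import Data.List.Properties using (length-tabulate)
open import Data.List.Relation.Unary.All as All using (All; []; _∷_)
import Data.List.Relation.Unary.All.Properties as All
open import Data.List.Relation.Unary.Any using (Any; here; there)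
import Data.List.Relation.Unary.Any.Properties as Any
open import Data.List.Relation.Unary.AllPairs using (AllPairs; []; _∷_)
import Data.List.Relation.Unary.AllPairs.Properties as AllPairs
open import Data.List.Membership.Propositional using (_∈_)
open import Function using (_∘_)
open import Relation.Nullary using (¬_; Dec; yes; no)
open import Relation.Unary.Properties using (∁?)
open import Relation.Binary using (Rel; Symmetric; tri<; tri≈; tri>)
open import Relation.Binary.PropositionalEquality
  using (_≡_; _≢_; refl; sym; trans; cong)

familyFromList : ∀ {a r} {A : Set a} {R : Rel A r} → Symmetric R →
  (m : ℕ) (L : List A) → AllPairs R L → m ≤ length L →
  Σ (Fin m → A) λ f → (∀ i → f i ∈ L) × (∀ i j → i ≢ j → R (f i) (f j))
familyFromList sym-R zero L _ _ = (λ ()) , (λ ()) , (λ ())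
familyFromList {A = A} {R} sym-R (suc m) (x ∷ L) (x~L ∷ L-pairs) (s≤s m≤|L|)
  with familyFromList sym-R m L L-pairs m≤|L|
... | g , g∈L , g-pairs = f , f∈xL , f-pairs
  where
  f : Fin (suc m) → A
  f fzero    = x
  f (fsuc i) = g i

  f∈xL : ∀ i → f i ∈ (x ∷ L)
  f∈xL fzero    = here refl
  f∈xL (fsuc i) = there (g∈L i)

  f-pairs : ∀ i j → i ≢ j → R (f i) (f j)
  f-pairs fzero    fzero    i≢j = ⊥-elim (i≢j refl)
  f-pairs fzero    (fsuc j) _   = All.lookup x~L (g∈L j)
  f-pairs (fsuc i) fzero    _   = sym-R (All.lookup x~L (g∈L i))
  f-pairs (fsuc i) (fsuc j) i≢j = g-pairs i j (i≢j ∘ cong fsuc)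

length-split : ∀ {a p} {A : Set a} {P : A → Set p} (P? : ∀ x → Dec (P x))
  (L : List A) → length (filter P? L) + length (filter (∁? P?) L) ≡ length L
length-split P? [] = refl
length-split P? (x ∷ L) with P? x
... | yes _ = cong suc (length-split P? L)
... | no  _ = trans (+-suc _ _) (cong suc (length-split P? L))

module _ {ℓ : Level} {M : Set ℓ} {n : ℕ} where

  Distinct-sym : Symmetric (Distinct {M = M} {n})
  Distinct-sym t≢s s≡t = t≢s (sym ∘ s≡t)

  Disjoint-sym : Symmetric (Disjoint {M = M} {n})
  Disjoint-sym t∩s k l e = t∩s l k (sym e)

  disjoint⇒distinct : ∀ {t s : Tuple M (suc n)} → Disjoint t s → Distinct t s
  disjoint⇒distinct t∩s t≡s = t∩s fzero fzero (t≡s fzero)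

  atMost⇒length≤ : ∀ {K} {P : Tuple M n → Set ℓ} → AtMost K P →
    (L : List (Tuple M n)) → AllPairs Distinct L → All P L → length L ≤ K
  atMost⇒length≤ {K} atMost L L-distinct L-P with length L ≤? K
  ... | yes |L|≤K = |L|≤K
  ... | no  |L|≰K with familyFromList Distinct-sym (suc K) L L-distinct (≰⇒> |L|≰K)
  ...   | f , f∈L , f-distinct = ⊥-elim (atMost f (All.lookup L-P ∘ f∈L) f-distinct)

  Meets : List M → Tuple M n → Set ℓ
  Meets A t = Any (λ a → OccursIn a t) A

  elements : List (Tuple M n) → List M
  elements []      = []
  elements (s ∷ L) = tabulate s ++ elements L

  missing⇒disjointFromAll : (L : List (Tuple M n)) (t : Tuple M n) →
    ¬ Meets (elements L) t → All (Disjoint t) L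
  missing⇒disjointFromAll []      t _ = []
  missing⇒disjointFromAll (s ∷ L) t t-misses =
    (λ k l tk≡sl → t-misses (Any.++⁺ˡ (Any.tabulate⁺ l (k , tk≡sl))))
    ∷ missing⇒disjointFromAll L t (t-misses ∘ Any.++⁺ʳ (tabulate s))

array⇒infinitelyMany : ∀ {ℓ} {M : Set ℓ} {n} {θ : Tuple M n → Set ℓ} →
  SupportsInfiniteArray θ → InfinitelyMany θ
array⇒infinitelyMany (d , d-θ , d-distinct , _) N =
  d ∘ toℕ , d-θ ∘ toℕ ,
  λ i j i≢j → d-distinct (toℕ i) (toℕ j) (i≢j ∘ toℕ-injective)

-- There is only one 0-tuple, so infinitely many realizations force arity ≥ 1.
infinitelyMany⇒positiveArity : ∀ {ℓ} {M : Set ℓ} {n} {θ : Tuple M n → Set ℓ} →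
  InfinitelyMany θ → Σ ℕ λ m → n ≡ suc m
infinitelyMany⇒positiveArity {n = suc m} _ = m , refl
infinitelyMany⇒positiveArity {n = zero} many with many 2
... | xs , _ , xs-distinct = ⊥-elim (xs-distinct fzero (fsuc fzero) (λ ()) (λ ()))

module _ {ℓ : Level} (em : ExcludedMiddle ℓ) {M : Set ℓ} {n : ℕ}
  (θ : Tuple M n → Set ℓ) (K : ℕ)
  (bound : (a : M) → AtMost K (λ t → θ t × OccursIn a t)) where

  meetingRealizations≤ : (A : List M) (L : List (Tuple M n)) →
    AllPairs Distinct L → All (λ t → θ t × Meets A t) L → length L ≤ length A * K
  meetingRealizations≤ [] [] _ _ = z≤n
  meetingRealizations≤ [] (_ ∷ _) _ ((_ , ()) ∷ _)
  meetingRealizations≤ (a ∷ A) L L-distinct L-meet =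
    ≤-trans (≤-reflexive (sym (length-split contains? L)))
            (+-mono-≤ through-a≤K avoiding-a≤|A|K)
    where
    contains? : ∀ t → Dec (OccursIn a t)
    contains? _ = em

    through-a≤K : length (filter contains? L) ≤ K
    through-a≤K = atMost⇒length≤ (bound a) (filter contains? L)
      (AllPairs.filter⁺ contains? L-distinct)
      (All.zipWith (λ ((θt , _) , a∈t) → θt , a∈t)
        (All.filter⁺ contains? L-meet , All.all-filter contains? L))

    meetsRest : ∀ {t} → θ t × Meets (a ∷ A) t → ¬ OccursIn a t → θ t × Meets A t
    meetsRest (_  , here a∈t)  a∉t = ⊥-elim (a∉t a∈t)
    meetsRest (θt , there A∩t) _   = θt , A∩t

    avoiding-a≤|A|K : length (filter (∁? contains?) L) ≤ length A * K
    avoiding-a≤|A|K = meetingRealizations≤ A (filter (∁? contains?) L)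
      (AllPairs.filter⁺ (∁? contains?) L-distinct)
      (All.zipWith (λ (m , a∉t) → meetsRest m a∉t)
        (All.filter⁺ (∁? contains?) L-meet , All.all-filter (∁? contains?) L))

  module _ (many : InfinitelyMany θ) where

    -- Every finite list of tuples admits a realization disjoint from all of
    -- them: of |elements L|·K + 1 distinct realizations, one misses them all.
    freshRealization : (L : List (Tuple M n)) →
      Σ (Tuple M n) λ t → θ t × All (Disjoint t) L
    freshRealization L with many (suc (length (elements L) * K))
    ... | xs , xs-θ , xs-distinct
      with em {Σ (Fin (suc (length (elements L) * K))) λ i → ¬ Meets (elements L) (xs i)}
    ... | yes (i , xsᵢ-misses) =
      xs i , xs-θ i , missing⇒disjointFromAll L (xs i) xsᵢ-misses
    ... | no none-misses = ⊥-elim (n≮n _ (≤-trans (≤-reflexive (sym (length-tabulate xs)))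
      (meetingRealizations≤ (elements L) (tabulate xs)
        (AllPairs.tabulate⁺ (xs-distinct _ _))
        (All.tabulate⁺ (λ i → xs-θ i , xsᵢ-meets i)))))
      where
      xsᵢ-meets : ∀ i → Meets (elements L) (xs i)
      xsᵢ-meets i with em {Meets (elements L) (xs i)}
      ... | yes meets = meets
      ... | no misses = ⊥-elim (none-misses (i , misses))

    -- The greedy sequence: earlier m is the list d_{m-1}, …, d₀, and d m is a
    -- realization disjoint from every tuple in it.
    earlier : ℕ → List (Tuple M n)
    earlier zero    = []
    earlier (suc m) = proj₁ (freshRealization (earlier m)) ∷ earlier m

    d : ℕ → Tuple M n
    d m = proj₁ (freshRealization (earlier m))

    earlier-complete : ∀ i j → i < j → d i ∈ earlier j
    earlier-complete i (suc j) (s≤s i≤j) with i ≟ j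
    ... | yes refl = here refl
    ... | no  i≢j  = there (earlier-complete i j (≤∧≢⇒< i≤j i≢j))

    -- Of two distinct indices, the later term was chosen disjoint from the earlier.
    d-disjoint : ∀ i j → i ≢ j → Disjoint (d i) (d j)
    d-disjoint i j i≢j with <-cmp i j
    ... | tri< i<j _ _ = Disjoint-sym (All.lookup (proj₂ (proj₂ (freshRealization (earlier j))))
                                                  (earlier-complete i j i<j))
    ... | tri≈ _ i≡j _ = ⊥-elim (i≢j i≡j)
    ... | tri> _ _ j<i = All.lookup (proj₂ (proj₂ (freshRealization (earlier i))))
                                    (earlier-complete j i j<i)

    -- The arity is positive, so the pairwise disjoint terms are pairwise distinct.
    infiniteArray : SupportsInfiniteArray θ
    infiniteArray with infinitelyMany⇒positiveArity {θ = θ} many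
    ... | _ , refl = d , (λ m → proj₁ (proj₂ (freshRealization (earlier m)))) ,
                     (λ i j i≢j → disjoint⇒distinct (d-disjoint i j i≢j)) , d-disjoint

lemma3 : ∀ {ℓ : Level} → ExcludedMiddle ℓ →
    (M : Set ℓ) (n : ℕ) (θ : Tuple M n → Set ℓ) →
    MutuallyAlgebraic θ →
    (SupportsInfiniteArray θ → InfinitelyMany θ) × (InfinitelyMany θ → SupportsInfiniteArray θ)
lemma3 em M n θ (K , bound) = array⇒infinitelyMany {θ = θ} , infiniteArray em θ K bound
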